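{- Let $y$ be produced by the segment construction described in the context. Then for all $v\in V\setminus\{1\}$, $y(C(T_v))\le h/w$.
   Context: Let $k\ge2$ and $n>2^k$ be integers, $c=2^k-2$, with $\gcd(c,n-1)=1$. Let $G$ be the path with vertex set $V=\{0,\dots,n-1\}$ and edges $\{v,v+1\}$, $0\le v\le n-2$. A search strategy for a tree $H$ is a rooted binary tree whose internal nodes are labeled by edges of $H$, defined recursively: a single node is a search strategy for any tree; otherwise the root is labeled by an edge $uv$ of $H$ and its two subtrees are search strategies for the connected components of $H-uv$ containing $u$ and $v$. Nodes carry vertex sets (root: $V(H)$; subtree roots recursively: those components' vertex sets). $C(T)$ is the set of $v$ with $\{v\}$ the vertex set of some leaf. Interval notation: $[a,b]=\{z\bmod n:a\le z\le b\}$ if $a\le b$, else $\emptyset$; $[v\oplus\ell]=[v,v+\ell-1]$. For $v\in V\setminus\{1\}$, $T_v$ is a search strategy of height at most $k$ with $C(T_v)=[v\oplus(c+1)]$ if $\{0,n-1\}\cap[v\oplus(c+1)]\ne\emptyset$ and $C(T_v)=[v\oplus c]$ otherwise. Let $h,w$ be the positive integers with $h(n-1)-wc=1$ and $0<w\le n-2$ minimal; $g(v)=v\cdot\frac{h}{wc}$, $r=\lfloor c/h\rfloor$, and $y(S)=\sum_{v\in S}y_v$. Segment construction of $y\in\mathbb R^V$: set $y_0=y_{n-1}=0$; starting with $v=1$, repeatedly let $r^*$ be the largest element of $\{r,r+1\}$ with $g(v+r^*-1)\le y([1,v-1])+\frac1w$ ($y([1,v-1])$ being the mass already assigned to $1,\dots,v-1$),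 set $y_i=\frac1{r^*w}$ for $i=v,\dots,v+r^*-1$, and set $v:=v+r^*$; stop when $v>n-2$. -}

module Defs where

open import Data.Nat using (ℕ; zero; suc; _+_; _*_; _∸_; _<ᵇ_; _≡ᵇ_)
open import Data.Nat.DivMod using (_/_; _%_)
open import Data.Bool using (Bool; true; false; if_then_else_; _∨_; _∧_)
open import Data.Integer using (+_)
open import Data.Product using (_×_; _,_)
open import Data.List using (List; []; _∷_; map; sum; foldr; upTo)
open import Data.Rational.Unnormalised
  using (ℚᵘ; 0ℚᵘ; _≤ᵇ_) renaming (_+_ to _+q_; _/_ to _/q_)

-- a / b as an (unnormalised) rational; junk value 0 when b = 0
-- (never used with b = 0 under the hypotheses of the lemma)
frac : ℕ → ℕ → ℚᵘ
frac a zero    = 0ℚᵘ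
frac a (suc b) = (+ a) /q (suc b)

divℕ : ℕ → ℕ → ℕ
divℕ a zero    = 0
divℕ a (suc b) = a / suc b

-- c = 2^k - 2 is passed as an argument below.
-- g(v) = v * h / (w c)
g : (c h w : ℕ) → ℕ → ℚᵘ
g c h w v = frac (v * h) (w * c)

-- Produces the list of segments (start v, length r*)
-- in order.  'fuel' bounds the number of iterations (fuel n suffices since
-- each step increases v by r* ≥ r ≥ 1).  'mass' is y([1,v-1]), the total
-- mass already assigned.  r* = r+1 if g(v+(r+1)-1) ≤ mass + 1/w, otherwise r.
segments : (n c h w : ℕ) → (fuel v : ℕ) → (mass : ℚᵘ) → List (ℕ × ℕ)
segments n c h w zero    v mass = []
segments n c h w (suc f) v mass =
  if (n ∸ 2) <ᵇ v then []
  else (v , rs) ∷ segments n c h w f (v + rs) (mass +q frac rs (rs * w))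
  where
  r  = divℕ c h
  rs = if g c h w (v + suc r ∸ 1) ≤ᵇ (mass +q frac 1 w) then suc r else r

segVal : (w : ℕ) → List (ℕ × ℕ) → ℕ → ℚᵘ
segVal w []             i = 0ℚᵘ
segVal w ((s , l) ∷ ss) i =
  if (i <ᵇ s) ∨ ((s + l) ∸ 1 <ᵇ i) then segVal w ss i else frac 1 (l * w)

-- the vector y ∈ ℚ^V produced by the segment construction
-- (y_0 = y_{n-1} = 0; vertices ≥ n are outside V and get 0).
yvec : (n c h w : ℕ) → ℕ → ℚᵘ
yvec n c h w i =
  if (i ≡ᵇ 0) ∨ ((n ∸ 1) <ᵇ (suc i) ) then 0ℚᵘ
  else segVal w (segments n c h w n 1 0ℚᵘ) i

-- [v ⊕ ℓ] = [v, v+ℓ-1] = { (v+j) mod n : 0 ≤ j < ℓ }, as a list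
-- (its elements are pairwise distinct when ℓ ≤ n).
intervalL : (n : ℕ) .{{_ : Data.Nat.NonZero n}} → (v ℓ : ℕ) → List ℕ
intervalL n v ℓ = map (λ j → (v + j) % n) (upTo ℓ)

hitsEnds : (n : ℕ) → List ℕ → Bool
hitsEnds n = foldr (λ z b → (z ≡ᵇ 0) ∨ (z ≡ᵇ (n ∸ 1)) ∨ b) false

CT : (n : ℕ) .{{_ : Data.Nat.NonZero n}} → (c v : ℕ) → List ℕ
CT n c v = if hitsEnds n (intervalL n v (suc c)) then intervalL n v (suc c)
           else intervalL n v c

ySum : (ℕ → ℚᵘ) → List ℕ → ℚᵘ
ySum y S = foldr (λ z acc → y z +q acc) 0ℚᵘ S

-- Write c = 2^k − 2 and n = p + 2.  The segment construction is a staircase: its t-th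
-- segment consists of the vertices ⌊tc/h⌋ + 1, …, ⌊(t+1)c/h⌋, because the greedy rule
-- takes the longer length r + 1 exactly when (v + r)·h ≤ (t+1)·c.  So every segment
-- carries mass 1/w, and as ⌊(t+h)c/h⌋ = ⌊tc/h⌋ + c, any c consecutive interior vertices
-- carry exactly h/w.  The Bézout identity h(p+1) = wc + 1 makes the segment lengths
-- symmetric under i ↦ p + 1 − i, and (since it forces gcd(c, h) = 1) under i ↦ c − i
-- within the first period.  A window C(T_v) is either a block of c interior vertices,
-- or such a block followed by the massless vertex n − 1, or it wraps around through n − 1
-- and 0; by the first symmetry the wrapped part [v, p] weighs as much as [1, p + 1 − v],
-- and by the second the first a vertices weigh at most the a + 1 vertices ending at c,
-- so a wrapped window weighs at most one period, h/w.

module Submission where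

open import Defs
open import Data.Nat
  using (ℕ; zero; suc; _+_; _*_; _∸_; _^_; _≤_; _<_; _≥_; _>_; NonZero; z≤n; s≤s; _<ᵇ_; _≡ᵇ_;
         >-nonZero; >-nonZero⁻¹)
open import Data.Nat.Properties
open import Data.Nat.DivMod
open import Data.Nat.Divisibility
  using (_∣_; divides; divides-refl; ∣m+n∣m⇒∣n; ∣⇒≤; ∣m⇒∣m*n; ∣n⇒∣m*n; ∣1⇒≡1)
open import Data.Nat.Coprimality using (Coprime; coprime-divisor)
open import Data.Nat.GCD using (gcd)
open import Data.Nat.Tactic.RingSolver using (solve-∀)
import Data.Integer as ℤ
import Data.Integer.Properties as ℤ
open import Data.Rational.Unnormalised using (ℚᵘ; mkℚᵘ; *≡*; *≤*; _≃_; 0ℚᵘ)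
  renaming (_+_ to _+q_; _≤_ to _≤q_; _≤ᵇ_ to _≤ᵇq_)
import Data.Rational.Unnormalised.Properties as ℚ
open import Data.Bool using (true; false; T; if_then_else_)
open import Data.Bool.Properties using (T-∨)
open import Data.Unit using (tt)
open import Data.List using (_∷_; map; applyUpTo)
open import Data.List.Membership.Propositional using (_∈_)
open import Data.List.Membership.Propositional.Properties using (∈-map⁺; ∈-upTo⁺)
open import Data.List.Relation.Unary.All using (All; _∷_)
import Data.List.Relation.Unary.All.Properties as All
open import Data.List.Relation.Unary.Any using (here; there)
open import Data.Product using (_×_; _,_)
open import Data.Sum using (_⊎_; inj₁; inj₂)
open import Data.Empty using (⊥-elim)
open import Function using (_∘_; Equivalence)
open import Relation.Binary.Definitions using (tri<; tri≈; tri>)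
open import Relation.Binary.PropositionalEquality
open import Relation.Nullary using (¬_; yes; no)

open Equivalence using (to; from)

frac-≃ : ∀ {a b a′ b′} → 0 < b → 0 < b′ → a * b′ ≡ a′ * b → frac a b ≃ frac a′ b′
frac-≃ {a} {suc b} {a′} {suc b′} _ _ e =
  *≡* (trans (sym (ℤ.pos-* a (suc b′))) (trans (cong ℤ.+_ e) (ℤ.pos-* a′ (suc b))))

frac-≤ : ∀ {a b a′ b′} → 0 < b → 0 < b′ → a * b′ ≤ a′ * b → frac a b ≤q frac a′ b′
frac-≤ {a} {suc b} {a′} {suc b′} _ _ le =
  *≤* (subst₂ ℤ._≤_ (ℤ.pos-* a (suc b′)) (ℤ.pos-* a′ (suc b)) (ℤ.+≤+ le))

frac-≤⁻¹ : ∀ {a b a′ b′} → 0 < b → 0 < b′ → frac a b ≤q frac a′ b′ → a * b′ ≤ a′ * b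
frac-≤⁻¹ {a} {suc b} {a′} {suc b′} _ _ (*≤* le) =
  ℤ.drop‿+≤+ (subst₂ ℤ._≤_ (sym (ℤ.pos-* a (suc b′))) (sym (ℤ.pos-* a′ (suc b))) le)

frac-+ : ∀ {a b a′ b′} → 0 < b → 0 < b′ →
         frac a b +q frac a′ b′ ≃ frac (a * b′ + a′ * b) (b * b′)
frac-+ {a} {suc b} {a′} {suc b′} _ _ = ℚ.≃-reflexive (cong₂ mkℚᵘ numerator refl)
  where
  numerator : ℤ.+ a ℤ.* ℤ.+ suc b′ ℤ.+ ℤ.+ a′ ℤ.* ℤ.+ suc b ≡ ℤ.+ (a * suc b′ + a′ * suc b)
  numerator = trans (cong₂ ℤ._+_ (sym (ℤ.pos-* a (suc b′))) (sym (ℤ.pos-* a′ (suc b))))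
                    (sym (ℤ.pos-+ (a * suc b′) (a′ * suc b)))

frac-+-same : ∀ {a a′ d} → 0 < d → frac a d +q frac a′ d ≃ frac (a + a′) d
frac-+-same {a} {a′} {d} 0<d = ℚ.≃-trans (frac-+ 0<d 0<d) (frac-≃ (*-mono-< 0<d 0<d) 0<d (cross a a′ d))
  where
  cross : ∀ a a′ d → (a * d + a′ * d) * d ≡ (a + a′) * (d * d)
  cross = solve-∀

frac-zero : ∀ {d} → 0 < d → frac 0 d ≃ 0ℚᵘ
frac-zero {suc d} _ = *≡* refl

frac-cancelˡ : ∀ {ℓ d} → 0 < ℓ → 0 < d → frac ℓ (ℓ * d) ≃ frac 1 d
frac-cancelˡ {ℓ} {d} 0<ℓ 0<d = frac-≃ (*-mono-< 0<ℓ 0<d) 0<d (sym (*-identityˡ (ℓ * d)))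

∑ : (ℕ → ℚᵘ) → ℕ → ℕ → ℚᵘ
∑ f s zero    = 0ℚᵘ
∑ f s (suc ℓ) = f s +q ∑ f (suc s) ℓ

∑-cong : ∀ {f g} s t ℓ → (∀ j → j < ℓ → f (s + j) ≡ g (t + j)) → ∑ f s ℓ ≡ ∑ g t ℓ
∑-cong s t zero    _  = refl
∑-cong {f} {g} s t (suc ℓ) eq =
  cong₂ _+q_ (subst₂ (λ x y → f x ≡ g y) (+-identityʳ s) (+-identityʳ t) (eq 0 (s≤s z≤n)))
    (∑-cong (suc s) (suc t) ℓ λ j j<ℓ →
      subst₂ (λ x y → f x ≡ g y) (+-suc s j) (+-suc t j) (eq (suc j) (s≤s j<ℓ)))

∑-split : ∀ f s a b → ∑ f s (a + b) ≡ ∑ f s a +q ∑ f (s + a) b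
∑-split f s zero    b = trans (cong (λ x → ∑ f x b) (sym (+-identityʳ s))) (sym (ℚ.+-identityˡ-≡ _))
∑-split f s (suc a) b = trans (cong (f s +q_) (trans (∑-split f (suc s) a b)
                                 (cong (λ x → ∑ f (suc s) a +q ∑ f x b) (sym (+-suc s a)))))
                              (sym (ℚ.+-assoc-≡ (f s) _ _))

∑-snoc : ∀ f s ℓ → ∑ f s (suc ℓ) ≡ ∑ f s ℓ +q f (s + ℓ)
∑-snoc f s ℓ = begin
  ∑ f s (suc ℓ)                         ≡⟨ cong (∑ f s) (+-comm 1 ℓ) ⟩
  ∑ f s (ℓ + 1)                         ≡⟨ ∑-split f s ℓ 1 ⟩
  ∑ f s ℓ +q (f (s + ℓ) +q 0ℚᵘ)         ≡⟨ cong (∑ f s ℓ +q_) (ℚ.+-identityʳ-≡ _) ⟩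
  ∑ f s ℓ +q f (s + ℓ)                  ∎
  where open ≡-Reasoning

∑-reverse : ∀ {f g} s t ℓ → (∀ j → j < ℓ → f (s + j) ≡ g (t + (ℓ ∸ suc j))) → ∑ f s ℓ ≡ ∑ g t ℓ
∑-reverse s t zero    _  = refl
∑-reverse {f} {g} s t (suc ℓ) eq = begin
  f s +q ∑ f (suc s) ℓ    ≡⟨ cong₂ _+q_ (trans (cong f (sym (+-identityʳ s))) (eq 0 (s≤s z≤n)))
                                        (∑-reverse (suc s) t ℓ λ j j<ℓ →
                                           trans (cong f (sym (+-suc s j))) (eq (suc j) (s≤s j<ℓ))) ⟩
  g (t + ℓ) +q ∑ g t ℓ    ≡⟨ ℚ.+-comm-≡ (g (t + ℓ)) _ ⟩
  ∑ g t ℓ +q g (t + ℓ)    ≡⟨ ∑-snoc g t ℓ ⟨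
  ∑ g t (suc ℓ)           ∎
  where open ≡-Reasoning

∑-rotate : ∀ f s ℓ → f (s + ℓ) ≡ f s → ∑ f (suc s) ℓ ≡ ∑ f s ℓ
∑-rotate f s zero    _  = refl
∑-rotate f s (suc ℓ) eq = begin
  ∑ f (suc s) (suc ℓ)         ≡⟨ ∑-snoc f (suc s) ℓ ⟩
  ∑ f (suc s) ℓ +q f (suc s + ℓ) ≡⟨ cong (λ x → ∑ f (suc s) ℓ +q f x) (sym (+-suc s ℓ)) ⟩
  ∑ f (suc s) ℓ +q f (s + suc ℓ) ≡⟨ cong (∑ f (suc s) ℓ +q_) eq ⟩
  ∑ f (suc s) ℓ +q f s           ≡⟨ ℚ.+-comm-≡ _ (f s) ⟩
  ∑ f s (suc ℓ)                  ∎
  where open ≡-Reasoning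

∑-periodic : ∀ f s ℓ → (∀ i → s ≤ i → f (i + ℓ) ≡ f i) → ∀ d → ∑ f (d + s) ℓ ≡ ∑ f s ℓ
∑-periodic f s ℓ per zero    = refl
∑-periodic f s ℓ per (suc d) =
  trans (∑-rotate f (d + s) ℓ (per (d + s) (m≤n+m s d))) (∑-periodic f s ℓ per d)

∑-const : ∀ f s ℓ {D} → 0 < D → (∀ j → j < ℓ → f (s + j) ≡ frac 1 D) → ∑ f s ℓ ≃ frac ℓ D
∑-const f s zero    0<D _  = ℚ.≃-sym (frac-zero 0<D)
∑-const f s (suc ℓ) 0<D eq = ℚ.≃-trans
  (ℚ.+-cong (ℚ.≃-reflexive (trans (cong f (sym (+-identityʳ s))) (eq 0 (s≤s z≤n))))
            (∑-const f (suc s) ℓ 0<D λ j j<ℓ → trans (cong f (sym (+-suc s j))) (eq (suc j) (s≤s j<ℓ))))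
  (frac-+-same 0<D)

m<[1+m/n]*n : ∀ m n .{{_ : NonZero n}} → m < suc (m / n) * n
m<[1+m/n]*n m n = subst (_< suc (m / n) * n) (sym (m≡m%n+[m/n]*n m n))
                        (+-monoˡ-< ((m / n) * n) (m%n<n m n))

m*n≤o⇒m≤o/n : ∀ m n o .{{_ : NonZero n}} → m * n ≤ o → m ≤ o / n
m*n≤o⇒m≤o/n m n o le = subst (_≤ o / n) (m*n/n≡m m n) (/-monoˡ-≤ n le)

/-unique : ∀ m n q .{{_ : NonZero n}} → q * n ≤ m → m < suc q * n → m / n ≡ q
/-unique m n q lo hi = ≤-antisym (≤-pred (m<n*o⇒m/o<n hi)) (m*n≤o⇒m≤o/n q n m lo)

+-suc-swap : ∀ m n → m + suc n ≡ n + suc m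
+-suc-swap m n = trans (+-suc m n) (trans (cong suc (+-comm m n)) (sym (+-suc n m)))

+≡+-cancel-≤ : ∀ x y z v → x + y ≡ z + v → v ≤ y → x ≤ z
+≡+-cancel-≤ x y z v eq le = +-cancelʳ-≤ y x z (subst (_≤ z + y) (sym eq) (+-monoʳ-≤ z le))

+≡+-cancel-< : ∀ x y z v → x + y ≡ z + v → v < y → x < z
+≡+-cancel-< x y z v eq lt = +-cancelʳ-< y x z (subst (_< z + y) (sym eq) (+-monoʳ-< z lt))

/-complement : ∀ A B N d .{{_ : NonZero d}} → A + B + 1 ≡ suc N * d → A / d + B / d ≡ N
/-complement A B N d eq = begin
    A / d + q      ≡⟨ cong (_+ q) (/-unique A d e lo hi) ⟩
    e + q          ≡⟨ m∸n+n≡m q≤N ⟩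
    N              ∎
  where
  open ≡-Reasoning
  q = B / d
  e = N ∸ q
  q≤N : q ≤ N
  q≤N = ≤-pred (m<n*o⇒m/o<n (≤-trans (s≤s (m≤n+m B A)) (≤-reflexive (trans (+-comm 1 (A + B)) eq))))
  split : A + (B + 1) ≡ e * d + (q * d + d)
  split = begin
    A + (B + 1)             ≡⟨ sym (+-assoc A B 1) ⟩
    A + B + 1               ≡⟨ eq ⟩
    suc N * d               ≡⟨ cong (λ x → suc x * d) (sym (m∸n+n≡m q≤N)) ⟩
    suc (e + q) * d         ≡⟨ ring e q d ⟩
    e * d + (q * d + d)     ∎
    where ring : ∀ e q d → suc (e + q) * d ≡ e * d + (q * d + d)
          ring = solve-∀
  lo : e * d ≤ A
  lo = +≡+-cancel-≤ (e * d) (q * d + d) A (B + 1) (sym split)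
         (subst₂ _≤_ (+-comm 1 B) (+-comm d (q * d)) (m<[1+m/n]*n B d))
  hi : A < suc e * d
  hi = subst (A <_) (+-comm (e * d) d)
         (+≡+-cancel-< A (B + 1) (e * d + d) (q * d) (trans split (ring (e * d) (q * d) d))
           (subst (q * d <_) (+-comm 1 B) (s≤s (m/n*n≤m B d))))
    where ring : ∀ x y z → x + (y + z) ≡ x + z + y
          ring = solve-∀

/-complement-∤ : ∀ A B N d .{{_ : NonZero d}} → A + B ≡ N * d → ¬ d ∣ B → A / d + B / d + 1 ≡ N
/-complement-∤ A B N d eq d∤B = begin
    A / d + q + 1    ≡⟨ cong (λ x → x + q + 1) (/-unique A d e lo hi) ⟩
    e + q + 1        ≡⟨ trans (+-assoc e q 1) (cong (e +_) (+-comm q 1)) ⟩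
    e + suc q        ≡⟨ m∸n+n≡m q<N ⟩
    N                ∎
  where
  open ≡-Reasoning
  q = B / d
  e = N ∸ suc q
  qd<B : q * d < B
  qd<B = ≤∧≢⇒< (m/n*n≤m B d) λ qd≡B → d∤B (divides q (sym qd≡B))
  q<N : q < N
  q<N = *-cancelʳ-< d q N (<-≤-trans qd<B (≤-trans (m≤n+m B A) (≤-reflexive eq)))
  split : A + B ≡ e * d + (q * d + d)
  split = begin
    A + B                   ≡⟨ eq ⟩
    N * d                   ≡⟨ cong (_* d) (sym (m∸n+n≡m q<N)) ⟩
    (e + suc q) * d         ≡⟨ ring e q d ⟩
    e * d + (q * d + d)     ∎
    where ring : ∀ e q d → (e + suc q) * d ≡ e * d + (q * d + d)
          ring = solve-∀
  lo : e * d ≤ A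
  lo = +≡+-cancel-≤ (e * d) (q * d + d) A B (sym split)
         (subst (B ≤_) (+-comm d (q * d)) (<⇒≤ (m<[1+m/n]*n B d)))
  hi : A < suc e * d
  hi = subst (A <_) (+-comm (e * d) d)
         (+≡+-cancel-< A B (e * d + d) (q * d) (trans split (ring (e * d) (q * d) d)) qd<B)
    where ring : ∀ x y z → x + (y + z) ≡ x + z + y
          ring = solve-∀

mirror-between : ∀ {a b a′ b′ Q i} → a′ + b + 1 ≡ Q → b′ + a + 1 ≡ Q →
                 a < i → i ≤ b → a′ < Q ∸ i × Q ∸ i ≤ b′
mirror-between {a} {b} {a′} {b′} {Q} {i} eq eq′ a<i i≤b =
  m+n≤o⇒m≤o∸n (suc a′) (≤-trans (+-monoʳ-≤ (suc a′) i≤b) (≤-reflexive (trans (+-comm 1 (a′ + b)) eq))) ,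
  m≤n+o⇒m∸n≤o Q i (begin
    Q             ≡⟨ trans (sym eq′) (+-assoc b′ a 1) ⟩
    b′ + (a + 1)  ≡⟨ cong (b′ +_) (+-comm a 1) ⟩
    b′ + suc a    ≤⟨ +-monoʳ-≤ b′ a<i ⟩
    b′ + i        ≡⟨ +-comm b′ i ⟩
    i + b′        ∎)
  where open ≤-Reasoning

∸-mirror : ∀ {a b a′ b′ Q} → a′ + b + 1 ≡ Q → b′ + a + 1 ≡ Q → b′ ∸ a′ ≡ b ∸ a
∸-mirror {a} {b} {a′} {b′} eq eq′ = begin
    b′ ∸ a′                ≡⟨ [m+n]∸[m+o]≡n∸o a b′ a′ ⟨
    (a + b′) ∸ (a + a′)    ≡⟨ cong₂ _∸_ (trans (+-comm a b′) b′+a≡a′+b) (+-comm a a′) ⟩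
    (a′ + b) ∸ (a′ + a)    ≡⟨ [m+n]∸[m+o]≡n∸o a′ b a ⟩
    b ∸ a                  ∎
  where
  open ≡-Reasoning
  b′+a≡a′+b : b′ + a ≡ a′ + b
  b′+a≡a′+b = +-cancelʳ-≡ 1 (b′ + a) (a′ + b) (trans eq′ (sym eq))

-- Segment t of the construction is the block of vertices cut t + 1, …, cut (t + 1).
module Staircase (c h : ℕ) {{_ : NonZero c}} {{_ : NonZero h}} where

  cut : ℕ → ℕ
  cut t = t * c / h

  r : ℕ
  r = c / h

  segLen : ℕ → ℕ
  segLen t = cut (suc t) ∸ cut t

  cut-mono : ∀ {t t′} → t ≤ t′ → cut t ≤ cut t′
  cut-mono le = /-monoˡ-≤ h (*-monoˡ-≤ c le)

  *<⇒cut< : ∀ t {i} → t * c < i * h → cut t < i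
  *<⇒cut< t = m<n*o⇒m/o<n

  ≤cut⇒*≤ : ∀ t {i} → i ≤ cut t → i * h ≤ t * c
  ≤cut⇒*≤ t le = ≤-trans (*-monoˡ-≤ h le) (m/n*n≤m (t * c) h)

  *≤⇒≤cut : ∀ t {i} → i * h ≤ t * c → i ≤ cut t
  *≤⇒≤cut t {i} = m*n≤o⇒m≤o/n i h (t * c)

  cut-zero : cut 0 ≡ 0
  cut-zero = 0/n≡0 h

  cut-one : cut 1 ≡ r
  cut-one = cong (_/ h) (*-identityˡ c)

  cut+r≤cut-suc : ∀ t → cut t + r ≤ cut (suc t)
  cut+r≤cut-suc t = *≤⇒≤cut (suc t) (begin
    (cut t + r) * h        ≡⟨ *-distribʳ-+ h (cut t) r ⟩
    cut t * h + r * h      ≤⟨ +-mono-≤ (m/n*n≤m (t * c) h) (m/n*n≤m c h) ⟩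
    t * c + c              ≡⟨ +-comm (t * c) c ⟩
    suc t * c              ∎)
    where open ≤-Reasoning

  cut-suc<cut+r+2 : ∀ t → cut (suc t) < cut t + suc (suc r)
  cut-suc<cut+r+2 t = *<⇒cut< (suc t) (begin-strict
    suc t * c                          ≡⟨ +-comm c (t * c) ⟩
    t * c + c                          <⟨ +-mono-< (m<[1+m/n]*n (t * c) h) (m<[1+m/n]*n c h) ⟩
    suc (cut t) * h + suc r * h        ≡⟨ ring (cut t) r h ⟩
    (cut t + suc (suc r)) * h          ∎)
    where
    open ≤-Reasoning
    ring : ∀ x y z → suc x * z + suc y * z ≡ (x + suc (suc y)) * z
    ring = solve-∀

  r≤segLen : ∀ t → r ≤ segLen t
  r≤segLen t = subst (_≤ segLen t) (m+n∸m≡n (cut t) r) (∸-monoˡ-≤ (cut t) (cut+r≤cut-suc t))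

  segLen≤suc-r : ∀ t → segLen t ≤ suc r
  segLen≤suc-r t = m≤n+o⇒m∸n≤o (cut (suc t)) (cut t)
    (≤-pred (subst (cut (suc t) <_) (+-suc (cut t) (suc r)) (cut-suc<cut+r+2 t)))

  cut-suc≡cut+segLen : ∀ t → cut (suc t) ≡ cut t + segLen t
  cut-suc≡cut+segLen t = sym (m+[n∸m]≡n (cut-mono (n≤1+n t)))

  cut-periodic : ∀ t → cut (t + h) ≡ cut t + c
  cut-periodic t = begin
    (t + h) * c / h            ≡⟨ cong (_/ h) (trans (*-distribʳ-+ c t h) (cong (t * c +_) (*-comm h c))) ⟩
    (t * c + c * h) / h        ≡⟨ +-distrib-/-∣ʳ (t * c) (divides-refl c) ⟩
    cut t + c * h / h          ≡⟨ cong (cut t +_) (m*n/n≡m c h) ⟩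
    cut t + c                  ∎
    where open ≡-Reasoning

  cut-h : cut h ≡ c
  cut-h = trans (cut-periodic 0) (cong (_+ c) cut-zero)

  record _∈seg_ (i t : ℕ) : Set where
    constructor inSeg
    field
      lower : cut t < i
      upper : i ≤ cut (suc t)

  open _∈seg_ public

  segOf : ℕ → ℕ
  segOf i = (i * h ∸ 1) / c

  segOf-∈ : ∀ {i} → 0 < i → i ∈seg segOf i
  segOf-∈ {i} 0<i = inSeg (*<⇒cut< (segOf i) (subst (segOf i * c <_) ih≡ (s≤s (m/n*n≤m (i * h ∸ 1) c))))
                          (*≤⇒≤cut (suc (segOf i)) (subst (_≤ suc (segOf i) * c) ih≡ (m<[1+m/n]*n (i * h ∸ 1) c)))
    where
    ih≡ : suc (i * h ∸ 1) ≡ i * h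
    ih≡ = trans (+-comm 1 _) (m∸n+n≡m (*-mono-≤ 0<i (>-nonZero⁻¹ h)))

  ∈seg⇒0< : ∀ {i t} → i ∈seg t → 0 < i
  ∈seg⇒0< (inSeg lo _) = ≤-trans (s≤s z≤n) lo

  ∈seg-≤ : ∀ {i t t′} → i ∈seg t → i ∈seg t′ → t ≤ t′
  ∈seg-≤ (inSeg lo _) (inSeg _ hi′) = ≮⇒≥ λ t′<t → <⇒≱ (<-≤-trans lo hi′) (cut-mono t′<t)

  ∈seg-unique : ∀ {i t t′} → i ∈seg t → i ∈seg t′ → t ≡ t′
  ∈seg-unique m m′ = ≤-antisym (∈seg-≤ m m′) (∈seg-≤ m′ m)

  ∈seg-periodic : ∀ {i t} → i ∈seg t → (i + c) ∈seg (t + h)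
  ∈seg-periodic {i} {t} (inSeg lo hi) =
    inSeg (subst (_< i + c) (sym (cut-periodic t)) (+-monoˡ-< c lo))
          (subst (i + c ≤_) (sym (cut-periodic (suc t))) (+-monoˡ-≤ c hi))

  segLen-periodic : ∀ t → segLen (t + h) ≡ segLen t
  segLen-periodic t = trans (cong₂ _∸_ (cut-periodic (suc t)) (cut-periodic t))
                            ([m+n]∸[m+o]≡n∸o′ (cut (suc t)) (cut t) c)
    where
    [m+n]∸[m+o]≡n∸o′ : ∀ m n o → m + o ∸ (n + o) ≡ m ∸ n
    [m+n]∸[m+o]≡n∸o′ m n o = trans (cong₂ _∸_ (+-comm m o) (+-comm n o)) ([m+n]∸[m+o]≡n∸o o m n)

  -- When the cuts around segment t and around segment S ∸ 1 ∸ t pair up to Q ∸ 1,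
  -- the reflection i ↦ Q ∸ i exchanges the two segments.
  module _ {S Q t : ℕ} (t<S : t < S)
           (outer : cut (S ∸ t) + cut t + 1 ≡ Q)
           (inner : cut (S ∸ suc t) + cut (suc t) + 1 ≡ Q) where

    private
      outer′ : cut (suc (S ∸ suc t)) + cut t + 1 ≡ Q
      outer′ = subst (λ s → cut s + cut t + 1 ≡ Q) (+-∸-assoc 1 t<S) outer

    ∈seg-mirror : ∀ {i} → i ∈seg t → (Q ∸ i) ∈seg (S ∸ suc t)
    ∈seg-mirror (inSeg lo hi) = let lo′ , hi′ = mirror-between inner outer′ lo hi in inSeg lo′ hi′

    segLen-mirror : segLen (S ∸ suc t) ≡ segLen t
    segLen-mirror = ∸-mirror {cut t} {cut (suc t)} inner outer′

<ᵇ-false : ∀ {m n} → n ≤ m → (m <ᵇ n) ≡ false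
<ᵇ-false {m} {n} n≤m with m <ᵇ n in eq
... | false = refl
... | true  = ⊥-elim (<⇒≱ (<ᵇ⇒< m n (subst T (sym eq) tt)) n≤m)

<ᵇ-true : ∀ {m n} → m < n → (m <ᵇ n) ≡ true
<ᵇ-true {m} {n} m<n with m <ᵇ n in eq
... | true  = refl
... | false = ⊥-elim (subst T eq (<⇒<ᵇ m<n))

divℕ≡/ : ∀ a b .{{_ : NonZero b}} → divℕ a b ≡ a / b
divℕ≡/ a (suc b) = refl

ySum-intervalL : ∀ (y : ℕ → ℚᵘ) n .{{_ : NonZero n}} v ℓ →
                 ySum y (intervalL n v ℓ) ≡ ∑ (λ i → y (i % n)) v ℓ
ySum-intervalL y n v ℓ =
  trans (go (λ j → j) 0 ℓ (λ _ → refl)) (cong (λ s → ∑ (λ i → y (i % n)) s ℓ) (+-identityʳ v))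
  where
  go : ∀ G t ℓ → (∀ j → G j ≡ t + j) →
       ySum y (map (λ j → (v + j) % n) (applyUpTo G ℓ)) ≡ ∑ (λ i → y (i % n)) (v + t) ℓ
  go G t zero    _  = refl
  go G t (suc ℓ) eq = cong₂ _+q_ (cong (λ j → y ((v + j) % n)) (trans (eq 0) (+-identityʳ t)))
    (trans (go (G ∘ suc) (suc t) ℓ (λ j → trans (eq (suc j)) (+-suc t j)))
           (cong (λ s → ∑ (λ i → y (i % n)) s ℓ) (+-suc v t)))

hitsEnds-∈ : ∀ n {x xs} → x ∈ xs → x ≡ 0 ⊎ x ≡ n ∸ 1 → T (hitsEnds n xs)
hitsEnds-∈ n     (here refl) (inj₁ refl) = tt
hitsEnds-∈ n {x} (here refl) (inj₂ x≡)   =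
  from (T-∨ {x ≡ᵇ 0}) (inj₂ (from (T-∨ {x ≡ᵇ n ∸ 1}) (inj₁ (≡⇒≡ᵇ x (n ∸ 1) x≡))))
hitsEnds-∈ n {xs = y ∷ _} (there x∈) e  =
  from (T-∨ {y ≡ᵇ 0}) (inj₂ (from (T-∨ {y ≡ᵇ n ∸ 1}) (inj₂ (hitsEnds-∈ n x∈ e))))

hitsEnds-avoid : ∀ n {xs} → All (λ x → x ≢ 0 × x ≢ n ∸ 1) xs → ¬ T (hitsEnds n xs)
hitsEnds-avoid n {x ∷ _} ((x≢0 , x≢e) ∷ rest) t with to T-∨ t
... | inj₁ t0 = x≢0 (≡ᵇ⇒≡ x 0 t0)
... | inj₂ t′ with to T-∨ t′
...   | inj₁ te = x≢e (≡ᵇ⇒≡ x (n ∸ 1) te)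
...   | inj₂ tr = hitsEnds-avoid n rest tr

module _ (n : ℕ) .{{_ : NonZero n}} (c v : ℕ) where

  CT-hit : ∀ j → j ≤ c → (v + j) % n ≡ 0 ⊎ (v + j) % n ≡ n ∸ 1 → CT n c v ≡ intervalL n v (suc c)
  CT-hit j j≤c end with hitsEnds n (intervalL n v (suc c))
                      | hitsEnds-∈ n (∈-map⁺ (λ j → (v + j) % n) (∈-upTo⁺ (s≤s j≤c))) end
  ... | true | _ = refl

  CT-miss : (∀ j → j ≤ c → (v + j) % n ≢ 0 × (v + j) % n ≢ n ∸ 1) → CT n c v ≡ intervalL n v c
  CT-miss avoid with hitsEnds n (intervalL n v (suc c))
                   | hitsEnds-avoid n (All.map⁺ (All.applyUpTo⁺₁ (λ j → j) (suc c) λ j<1+c → avoid _ (≤-pred j<1+c)))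
  ... | true  | ¬t = ⊥-elim (¬t tt)
  ... | false | _  = refl

-- Consequences of the Bézout identity

module Balanced (c h w p : ℕ) {{_ : NonZero c}} {{_ : NonZero h}} {{_ : NonZero w}}
                (bezout : h * suc p ≡ w * c + 1) (w≤p : w ≤ p) where

  open Staircase c h public

  n : ℕ
  n = suc (suc p)

  0<w : 0 < w
  0<w = >-nonZero⁻¹ w

  cut-reflect : ∀ s → s ≤ w → cut (w ∸ s) + cut s + 1 ≡ suc p
  cut-reflect s s≤w = trans (+-comm _ 1) (cong suc (/-complement ((w ∸ s) * c) (s * c) p h (begin
    (w ∸ s) * c + s * c + 1   ≡⟨ cong (_+ 1) (sym (*-distribʳ-+ c (w ∸ s) s)) ⟩
    (w ∸ s + s) * c + 1       ≡⟨ cong (λ x → x * c + 1) (m∸n+n≡m s≤w) ⟩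
    w * c + 1                 ≡⟨ sym bezout ⟩
    h * suc p                 ≡⟨ *-comm h (suc p) ⟩
    suc p * h                 ∎)))
    where open ≡-Reasoning

  cut-w : cut w ≡ p
  cut-w = suc-injective (begin
    suc (cut w)            ≡⟨ +-comm 1 (cut w) ⟩
    cut w + 1              ≡⟨ cong (λ x → x + 1) (+-identityʳ (cut w)) ⟨
    cut w + 0 + 1          ≡⟨ cong (λ x → cut w + x + 1) cut-zero ⟨
    cut w + cut 0 + 1      ≡⟨ cut-reflect 0 z≤n ⟩
    suc p                  ∎)
    where open ≡-Reasoning

  coprime : Coprime h c
  coprime {d} (d∣h , d∣c) =
    ∣1⇒≡1 (∣m+n∣m⇒∣n (subst (d ∣_) bezout (∣m⇒∣m*n (suc p) d∣h)) (∣n⇒∣m*n w d∣c))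

  cut-antisym : ∀ s → 0 < s → s < h → cut (h ∸ s) + cut s + 1 ≡ c
  cut-antisym s 0<s s<h = /-complement-∤ ((h ∸ s) * c) (s * c) c h sum h∤sc
    where
    sum : (h ∸ s) * c + s * c ≡ c * h
    sum = trans (sym (*-distribʳ-+ c (h ∸ s) s)) (trans (cong (_* c) (m∸n+n≡m (<⇒≤ s<h))) (*-comm h c))
    h∤sc : ¬ h ∣ s * c
    h∤sc h∣sc = <⇒≱ s<h (∣⇒≤ {{>-nonZero 0<s}} (coprime-divisor coprime (subst (h ∣_) (*-comm s c) h∣sc)))

  h≤c : h ≤ c
  h≤c = ≮⇒≥ λ c<h → <-irrefl refl (begin-strict
    w * c + 1           ≤⟨ +-monoˡ-≤ 1 (*-monoˡ-≤ c w≤p) ⟩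
    p * c + 1           <⟨ +-monoʳ-< (p * c) (s≤s (≤-trans (>-nonZero⁻¹ c) (m≤n+m c p))) ⟩
    p * c + (suc p + c) ≡⟨ ring c p ⟩
    suc c * suc p       ≤⟨ *-monoˡ-≤ (suc p) c<h ⟩
    h * suc p           ≡⟨ bezout ⟩
    w * c + 1           ∎)
    where
    open ≤-Reasoning
    ring : ∀ c p → p * c + (suc p + c) ≡ suc c * suc p
    ring = solve-∀

  0<r : 0 < r
  0<r = m*n≤o⇒m≤o/n 1 h c (subst (_≤ c) (sym (*-identityˡ h)) h≤c)

  0<segLen : ∀ t → 0 < segLen t
  0<segLen t = <-≤-trans 0<r (r≤segLen t)

  -- The constructed vector on 1, …, p (see yvec-interior), continued to all i ≥ 1.
  ŷ : ℕ → ℚᵘ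
  ŷ i = frac 1 (segLen (segOf i) * w)

  ŷ-∈seg : ∀ {i t} → i ∈seg t → ŷ i ≡ frac 1 (segLen t * w)
  ŷ-∈seg m = cong (λ s → frac 1 (segLen s * w)) (∈seg-unique (segOf-∈ (∈seg⇒0< m)) m)

  ŷ-periodic : ∀ {i} → 0 < i → ŷ (i + c) ≡ ŷ i
  ŷ-periodic {i} 0<i = trans (ŷ-∈seg (∈seg-periodic (segOf-∈ 0<i)))
                             (cong (λ l → frac 1 (l * w)) (segLen-periodic (segOf i)))

  segOf<w : ∀ {i} → 0 < i → i ≤ p → segOf i < w
  segOf<w {i} 0<i i≤p = ≰⇒> λ w≤t →
    <⇒≱ (<-≤-trans (lower (segOf-∈ 0<i)) i≤p) (subst (_≤ cut (segOf i)) cut-w (cut-mono w≤t))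

  ŷ-reflect : ∀ {i} → 0 < i → i ≤ p → ŷ (suc p ∸ i) ≡ ŷ i
  ŷ-reflect {i} 0<i i≤p = trans (ŷ-∈seg (∈seg-mirror t<w outer inner m))
                                (trans (cong (λ l → frac 1 (l * w)) (segLen-mirror t<w outer inner)) (sym (ŷ-∈seg m)))
    where
    t = segOf i
    m = segOf-∈ 0<i
    t<w = segOf<w 0<i i≤p
    outer = cut-reflect t (<⇒≤ t<w)
    inner = cut-reflect (suc t) t<w

  ŷ-antisym : ∀ {i} → r < i → i ≤ cut (h ∸ 1) → ŷ (c ∸ i) ≡ ŷ i
  ŷ-antisym {i} r<i i≤cut = trans (ŷ-∈seg (∈seg-mirror t<h outer inner m))
                                  (trans (cong (λ l → frac 1 (l * w)) (segLen-mirror t<h outer inner)) (sym (ŷ-∈seg m)))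
    where
    t = segOf i
    m = segOf-∈ (≤-trans (s≤s z≤n) r<i)
    0<t : 0 < t
    0<t = n≢0⇒n>0 λ t≡0 → <⇒≱ r<i (subst (i ≤_) cut-one (subst (λ s → i ≤ cut (suc s)) t≡0 (upper m)))
    suc-t<h : suc t < h
    suc-t<h = ≰⇒> λ h≤suc-t → <⇒≱ (<-≤-trans (lower m) i≤cut) (cut-mono (m≤n+o⇒m∸n≤o h 1 h≤suc-t))
    t<h = <-trans (n<1+n t) suc-t<h
    outer = cut-antisym t 0<t t<h
    inner = cut-antisym (suc t) (s≤s z≤n) suc-t<h

  ∑ŷ-segment : ∀ t → ∑ ŷ (suc (cut t)) (segLen t) ≃ frac 1 w
  ∑ŷ-segment t = ℚ.≃-trans (∑-const ŷ (suc (cut t)) (segLen t) (*-mono-< (0<segLen t) 0<w) in-t)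
                           (frac-cancelˡ (0<segLen t) 0<w)
    where
    in-t : ∀ j → j < segLen t → ŷ (suc (cut t) + j) ≡ frac 1 (segLen t * w)
    in-t j j<l = ŷ-∈seg {t = t} (inSeg (s≤s (m≤m+n (cut t) j))
                         (subst (suc (cut t) + j ≤_) (sym (cut-suc≡cut+segLen t))
                           (subst (_≤ cut t + segLen t) (+-suc (cut t) j) (+-monoʳ-≤ (cut t) j<l))))

  ∑ŷ-cut : ∀ T → ∑ ŷ 1 (cut T) ≃ frac T w
  ∑ŷ-cut zero    = subst (λ x → ∑ ŷ 1 x ≃ frac 0 w) (sym cut-zero) (ℚ.≃-sym (frac-zero 0<w))
  ∑ŷ-cut (suc T) = begin
    ∑ ŷ 1 (cut (suc T))                             ≡⟨ cong (∑ ŷ 1) (cut-suc≡cut+segLen T) ⟩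
    ∑ ŷ 1 (cut T + segLen T)                        ≡⟨ ∑-split ŷ 1 (cut T) (segLen T) ⟩
    ∑ ŷ 1 (cut T) +q ∑ ŷ (suc (cut T)) (segLen T)   ≈⟨ ℚ.+-cong (∑ŷ-cut T) (∑ŷ-segment T) ⟩
    frac T w +q frac 1 w                            ≈⟨ frac-+-same 0<w ⟩
    frac (T + 1) w                                  ≡⟨ cong (λ x → frac x w) (+-comm T 1) ⟩
    frac (suc T) w                                  ∎
    where open ℚ.≃-Reasoning

  ∑ŷ-period : ∑ ŷ 1 c ≃ frac h w
  ∑ŷ-period = subst (λ x → ∑ ŷ 1 x ≃ frac h w) cut-h (∑ŷ-cut h)

  ∑ŷ-window : ∀ s → 0 < s → ∑ ŷ s c ≃ frac h w
  ∑ŷ-window s 0<s = ℚ.≃-trans (ℚ.≃-reflexive (begin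
    ∑ ŷ s c              ≡⟨ cong (λ x → ∑ ŷ x c) (m∸n+n≡m 0<s) ⟨
    ∑ ŷ (s ∸ 1 + 1) c    ≡⟨ ∑-periodic ŷ 1 c (λ _ → ŷ-periodic) (s ∸ 1) ⟩
    ∑ ŷ 1 c              ∎)) ∑ŷ-period
    where open ≡-Reasoning

  ∑ŷ-reflect : ∀ {v a} → 0 < v → v + a ≡ suc p → ∑ ŷ v a ≡ ∑ ŷ 1 a
  ∑ŷ-reflect {v} {a} 0<v v+a≡ = ∑-reverse v 1 a λ j j<a →
    let i≡ : 1 + (a ∸ suc j) ≡ a ∸ j
        i≡ = sym (+-∸-assoc 1 j<a)
    in begin
    ŷ (v + j)                ≡⟨ cong ŷ (position j (<⇒≤ j<a)) ⟩
    ŷ (suc p ∸ (a ∸ j))      ≡⟨ ŷ-reflect (m<n⇒0<n∸m j<a) (≤-trans (m∸n≤m a j) a≤p) ⟩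
    ŷ (a ∸ j)                ≡⟨ cong ŷ i≡ ⟨
    ŷ (1 + (a ∸ suc j))      ∎
    where
    open ≡-Reasoning
    a≤p : a ≤ p
    a≤p = ≤-pred (subst (a <_) v+a≡ (+-monoˡ-≤ a 0<v))
    position : ∀ j → j ≤ a → v + j ≡ suc p ∸ (a ∸ j)
    position j j≤a = begin
      v + j                  ≡⟨ cong (v +_) (m∸[m∸n]≡n j≤a) ⟨
      v + (a ∸ (a ∸ j))      ≡⟨ +-∸-assoc v (m∸n≤m a j) ⟨
      v + a ∸ (a ∸ j)        ≡⟨ cong (_∸ (a ∸ j)) v+a≡ ⟩
      suc p ∸ (a ∸ j)        ∎

  segLen-first : segLen 0 ≡ r
  segLen-first = cong₂ _∸_ cut-one cut-zero

  ŷ-first : ∀ {i} → 0 < i → i ≤ r → ŷ i ≡ frac 1 (r * w)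
  ŷ-first 0<i i≤r = trans (ŷ-∈seg {t = 0} (inSeg (subst (_< _) (sym cut-zero) 0<i) (subst (_ ≤_) (sym cut-one) i≤r)))
                          (cong (λ l → frac 1 (l * w)) segLen-first)

  module _ (1<h : 1 < h) where

    private
      suc-h∸1 : suc (h ∸ 1) ≡ h
      suc-h∸1 = trans (+-comm 1 (h ∸ 1)) (m∸n+n≡m (<⇒≤ 1<h))

    cut-last : cut (h ∸ 1) + suc r ≡ c
    cut-last = begin
      cut (h ∸ 1) + suc r        ≡⟨ cong (cut (h ∸ 1) +_) (+-comm 1 r) ⟩
      cut (h ∸ 1) + (r + 1)      ≡⟨ +-assoc (cut (h ∸ 1)) r 1 ⟨
      cut (h ∸ 1) + r + 1        ≡⟨ cong (λ x → cut (h ∸ 1) + x + 1) cut-one ⟨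
      cut (h ∸ 1) + cut 1 + 1    ≡⟨ cut-antisym 1 (s≤s z≤n) 1<h ⟩
      c                          ∎
      where open ≡-Reasoning

    segLen-last : segLen (h ∸ 1) ≡ suc r
    segLen-last = begin
      cut (suc (h ∸ 1)) ∸ cut (h ∸ 1)   ≡⟨ cong (λ x → cut x ∸ cut (h ∸ 1)) suc-h∸1 ⟩
      cut h ∸ cut (h ∸ 1)               ≡⟨ cong (_∸ cut (h ∸ 1)) (trans cut-h (sym cut-last)) ⟩
      cut (h ∸ 1) + suc r ∸ cut (h ∸ 1) ≡⟨ m+n∸m≡n (cut (h ∸ 1)) (suc r) ⟩
      suc r                             ∎
      where open ≡-Reasoning

    ŷ-last : ∀ {i} → cut (h ∸ 1) < i → i ≤ c → ŷ i ≡ frac 1 (suc r * w)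
    ŷ-last lo hi = trans (ŷ-∈seg {t = h ∸ 1} (inSeg lo
                           (subst (λ x → _ ≤ cut x) (sym suc-h∸1) (subst (_ ≤_) (sym cut-h) hi))))
                         (cong (λ l → frac 1 (l * w)) segLen-last)

    ŷ-tail : ∀ {a b} → a + suc b ≡ c → a ≤ r → ∀ j → j < suc a → ŷ (suc b + j) ≡ frac 1 (suc r * w)
    ŷ-tail {a} {b} a+b+1≡c a≤r j j≤a = ŷ-last (≤-trans (s≤s cut≤b) (m≤m+n (suc b) j))
      (subst (suc b + j ≤_) (trans (+-comm (suc b) a) a+b+1≡c) (+-monoʳ-≤ (suc b) (≤-pred j≤a)))
      where
      open ≤-Reasoning
      cut≤b : cut (h ∸ 1) ≤ b
      cut≤b = +-cancelʳ-≤ (suc r) (cut (h ∸ 1)) b (begin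
        cut (h ∸ 1) + suc r   ≡⟨ trans cut-last (sym a+b+1≡c) ⟩
        a + suc b             ≤⟨ +-monoˡ-≤ (suc b) a≤r ⟩
        r + suc b             ≡⟨ trans (+-comm r (suc b)) (sym (+-suc b r)) ⟩
        b + suc r             ∎)

    head≤tail-short : ∀ {a b} → a + suc b ≡ c → a ≤ r → ∑ ŷ 1 a ≤q ∑ ŷ (suc b) (suc a)
    head≤tail-short {a} {b} a+b+1≡c a≤r = begin
      ∑ ŷ 1 a                  ≃⟨ ∑-const ŷ 1 a (*-mono-< 0<r 0<w) head ⟩
      frac a (r * w)           ≤⟨ frac-≤ (*-mono-< 0<r 0<w) 0<[1+r]w cross ⟩
      frac (suc a) (suc r * w) ≃⟨ ∑-const ŷ (suc b) (suc a) 0<[1+r]w (ŷ-tail a+b+1≡c a≤r) ⟨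
      ∑ ŷ (suc b) (suc a)      ∎
      where
      open ℚ.≤-Reasoning
      head : ∀ j → j < a → ŷ (1 + j) ≡ frac 1 (r * w)
      head j j<a = ŷ-first (s≤s z≤n) (≤-trans j<a a≤r)
      0<[1+r]w : 0 < suc r * w
      0<[1+r]w = *-mono-< (s≤s (z≤n {r})) 0<w
      cross : a * (suc r * w) ≤ suc a * (r * w)
      cross = subst₂ _≤_ (sym (ring₁ a r w)) (sym (ring₂ a r w)) (*-monoˡ-≤ w (+-monoˡ-≤ (a * r) a≤r))
        where
        ring₁ : ∀ a r w → a * (suc r * w) ≡ (a + a * r) * w
        ring₁ = solve-∀
        ring₂ : ∀ a r w → suc a * (r * w) ≡ (r + a * r) * w
        ring₂ = solve-∀

    -- The first segment (length r) and the last one (length r + 1) both weigh 1/w, and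
    -- the reflection i ↦ c ∸ i matches the vertices in between.
    head≃tail-long : ∀ {a b} → a + suc b ≡ c → r ≤ a → r ≤ b → ∑ ŷ 1 a ≃ ∑ ŷ (suc b) (suc a)
    head≃tail-long {a} {b} a+b+1≡c r≤a r≤b with m≤n⇒∃[o]m+o≡n r≤a | m≤n⇒∃[o]m+o≡n r≤b
    ... | m , refl | d , refl = begin
      ∑ ŷ 1 (r + m)                                  ≡⟨ ∑-split ŷ 1 r m ⟩
      ∑ ŷ 1 r +q ∑ ŷ (suc r) m                       ≈⟨ ℚ.+-cong first-segment (ℚ.≃-reflexive middle) ⟩
      frac 1 w +q ∑ ŷ (suc b) m                      ≡⟨ ℚ.+-comm-≡ (frac 1 w) _ ⟩
      ∑ ŷ (suc b) m +q frac 1 w                      ≈⟨ ℚ.+-congʳ (∑ ŷ (suc b) m) last-segment ⟨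
      ∑ ŷ (suc b) m +q ∑ ŷ (suc b + m) (suc r)       ≡⟨ ∑-split ŷ (suc b) m (suc r) ⟨
      ∑ ŷ (suc b) (m + suc r)                        ≡⟨ cong (∑ ŷ (suc b)) (trans (+-suc m r) (cong suc (+-comm m r))) ⟩
      ∑ ŷ (suc b) (suc (r + m))                      ∎
      where
      open ℚ.≃-Reasoning
      cut≡b+m : cut (h ∸ 1) ≡ b + m
      cut≡b+m = +-cancelʳ-≡ (suc r) (cut (h ∸ 1)) (b + m) (trans cut-last (trans (sym a+b+1≡c) (ring r m d)))
        where ring : ∀ r m d → r + m + suc (r + d) ≡ r + d + m + suc r
              ring = solve-∀
      first-segment : ∑ ŷ 1 r ≃ frac 1 w
      first-segment = subst₂ (λ s l → ∑ ŷ (suc s) l ≃ frac 1 w) cut-zero segLen-first (∑ŷ-segment 0)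
      last-segment : ∑ ŷ (suc b + m) (suc r) ≃ frac 1 w
      last-segment = subst₂ (λ s l → ∑ ŷ (suc s) l ≃ frac 1 w) cut≡b+m segLen-last (∑ŷ-segment (h ∸ 1))
      mirror : ∀ j → j < m → c ∸ (suc r + j) ≡ suc b + (m ∸ suc j)
      mirror j j<m = trans (cong (_∸ (suc r + j)) c≡) (m+n∸m≡n (suc r + j) _)
        where
        ring : ∀ r j b x → suc b + (r + (suc j + x)) ≡ (suc r + j) + (suc b + x)
        ring = solve-∀
        c≡ : c ≡ (suc r + j) + (suc b + (m ∸ suc j))
        c≡ = trans (sym a+b+1≡c) (trans (+-comm (r + m) (suc b))
               (trans (cong (λ x → suc b + (r + x)) (sym (m+[n∸m]≡n j<m))) (ring r j b (m ∸ suc j))))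
      middle : ∑ ŷ (suc r) m ≡ ∑ ŷ (suc b) m
      middle = ∑-reverse (suc r) (suc b) m λ j j<m →
        trans (sym (ŷ-antisym (s≤s (m≤m+n r j))
                 (subst (suc r + j ≤_) (sym cut≡b+m)
                   (≤-trans (subst (_≤ r + m) (+-suc r j) (+-monoʳ-≤ r j<m))
                            (≤-trans (m≤m+n (r + m) d) (≤-reflexive (ring′ r m d)))))))
              (cong ŷ (mirror j j<m))
        where ring′ : ∀ r m d → r + m + d ≡ r + d + m
              ring′ = solve-∀

  head≤tail-h≡1 : h ≡ 1 → ∀ {a b} → a + suc b ≡ c → ∑ ŷ 1 a ≤q ∑ ŷ (suc b) (suc a)
  head≤tail-h≡1 h≡1 {a} {b} _ = begin
    ∑ ŷ 1 a                  ≃⟨ ∑-const ŷ 1 a 0<cw (λ j _ → ŷ≡ (1 + j)) ⟩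
    frac a (c * w)           ≤⟨ frac-≤ 0<cw 0<cw (*-monoˡ-≤ (c * w) (n≤1+n a)) ⟩
    frac (suc a) (c * w)     ≃⟨ ∑-const ŷ (suc b) (suc a) 0<cw (λ j _ → ŷ≡ (suc b + j)) ⟨
    ∑ ŷ (suc b) (suc a)      ∎
    where
    open ℚ.≤-Reasoning
    0<cw : 0 < c * w
    0<cw = *-mono-< (>-nonZero⁻¹ c) 0<w
    cut≡ : ∀ t → cut t ≡ t * c
    cut≡ t = trans (/-congʳ h≡1) (n/1≡n (t * c))
    ŷ≡ : ∀ i → ŷ i ≡ frac 1 (c * w)
    ŷ≡ i = cong (λ l → frac 1 (l * w))
             (trans (cong₂ _∸_ (cut≡ (suc (segOf i))) (cut≡ (segOf i))) (m+n∸n≡m c (segOf i * c)))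

  ∑ŷ-wrap-from : ∀ {a b} → a + suc b ≡ c → ∑ ŷ 1 a ≤q ∑ ŷ (suc b) (suc a) →
                 ∑ ŷ 1 a +q ∑ ŷ 1 b ≤q frac h w
  ∑ŷ-wrap-from {a} {b} a+b+1≡c head≤tail = begin
    ∑ ŷ 1 a +q ∑ ŷ 1 b              ≤⟨ ℚ.+-monoˡ-≤ (∑ ŷ 1 b) head≤tail ⟩
    ∑ ŷ (suc b) (suc a) +q ∑ ŷ 1 b  ≡⟨ ℚ.+-comm-≡ (∑ ŷ (suc b) (suc a)) _ ⟩
    ∑ ŷ 1 b +q ∑ ŷ (suc b) (suc a)  ≡⟨ ∑-split ŷ 1 b (suc a) ⟨
    ∑ ŷ 1 (b + suc a)               ≡⟨ cong (∑ ŷ 1) (trans (+-suc-swap b a) a+b+1≡c) ⟩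
    ∑ ŷ 1 c                         ≃⟨ ∑ŷ-period ⟩
    frac h w                        ∎
    where open ℚ.≤-Reasoning

  ∑ŷ-wrap : ∀ {a b} → a + suc b ≡ c → ∑ ŷ 1 a +q ∑ ŷ 1 b ≤q frac h w
  ∑ŷ-wrap {a} {b} a+b+1≡c with 1 <? h
  ... | no  h≯1 = ∑ŷ-wrap-from a+b+1≡c (head≤tail-h≡1 (≤-antisym (≮⇒≥ h≯1) (>-nonZero⁻¹ h)) a+b+1≡c)
  ... | yes 1<h with a ≤? r | b ≤? r
  ...   | yes a≤r | _       = ∑ŷ-wrap-from a+b+1≡c (head≤tail-short 1<h a+b+1≡c a≤r)
  ...   | no  a≰r | yes b≤r = subst (_≤q frac h w) (ℚ.+-comm-≡ (∑ ŷ 1 b) (∑ ŷ 1 a))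
                                 (∑ŷ-wrap-from b+a+1≡c (head≤tail-short 1<h b+a+1≡c b≤r))
    where b+a+1≡c = trans (+-suc-swap b a) a+b+1≡c
  ...   | no  a≰r | no  b≰r =
    ∑ŷ-wrap-from a+b+1≡c
      (ℚ.≤-reflexive (head≃tail-long 1<h a+b+1≡c (<⇒≤ (≰⇒> a≰r)) (<⇒≤ (≰⇒> b≰r))))

  -- The segment construction follows the staircase

  divℕ-c-h : divℕ c h ≡ r
  divℕ-c-h = divℕ≡/ c h

  -- The local choice rs of Defs.segments, with divℕ c h written as r.
  choice : ℕ → ℚᵘ → ℕ
  choice v mass = if g c h w (v + suc r ∸ 1) ≤ᵇq (mass +q frac 1 w) then suc r else r

  segments-step : ∀ f v mass → v ≤ p →
    segments n c h w (suc f) v mass ≡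
    (v , choice v mass) ∷ segments n c h w f (v + choice v mass) (mass +q frac (choice v mass) (choice v mass * w))
  segments-step f v mass v≤p rewrite <ᵇ-false v≤p | divℕ-c-h = refl

  private
    0<wc : 0 < w * c
    0<wc = *-mono-< 0<w (>-nonZero⁻¹ c)

    rearrange : ∀ t → suc t * (w * c) ≡ suc t * c * w
    rearrange t = ring t w c
      where ring : ∀ t w c → suc t * (w * c) ≡ suc t * c * w
            ring = solve-∀

  g≤⇒*≤ : ∀ x t → g c h w x ≤q frac (suc t) w → x * h ≤ suc t * c
  g≤⇒*≤ x t le = *-cancelʳ-≤ (x * h) (suc t * c) w
                   (subst (x * h * w ≤_) (rearrange t) (frac-≤⁻¹ 0<wc 0<w le))

  *≤⇒g≤ : ∀ x t → x * h ≤ suc t * c → g c h w x ≤q frac (suc t) w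
  *≤⇒g≤ x t le = frac-≤ 0<wc 0<w (subst (x * h * w ≤_) (sym (rearrange t)) (*-monoˡ-≤ w le))

  mass+1/w : ∀ {t mass} → mass ≃ frac t w → mass +q frac 1 w ≃ frac (suc t) w
  mass+1/w {t} {mass} mass≃ = begin
    mass +q frac 1 w           ≈⟨ ℚ.+-congˡ (frac 1 w) mass≃ ⟩
    frac t w +q frac 1 w       ≈⟨ frac-+-same 0<w ⟩
    frac (t + 1) w             ≡⟨ cong (λ x → frac x w) (+-comm t 1) ⟩
    frac (suc t) w             ∎
    where open ℚ.≃-Reasoning

  choice-cut : ∀ t mass → mass ≃ frac t w → choice (suc (cut t)) mass ≡ segLen t
  choice-cut t mass mass≃ with g c h w (cut t + suc r) ≤ᵇq (mass +q frac 1 w) in eq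
  ... | true  = sym (≤-antisym (segLen≤suc-r t)
                 (m+n≤o⇒m≤o∸n (suc r) (subst (_≤ cut (suc t)) (+-comm (cut t) (suc r)) long)))
    where
    long : cut t + suc r ≤ cut (suc t)
    long = *≤⇒≤cut (suc t) (g≤⇒*≤ (cut t + suc r) t
             (ℚ.≤-trans (ℚ.≤ᵇ⇒≤ (subst T (sym eq) tt)) (ℚ.≤-reflexive (mass+1/w mass≃))))
  ... | false = sym (≤-antisym (m≤n+o⇒m∸n≤o (cut (suc t)) (cut t)
                                 (≤-pred (subst (cut (suc t) <_) (+-suc (cut t) r) short)))
                              (r≤segLen t))
    where
    short : cut (suc t) < cut t + suc r
    short = ≰⇒> λ long → subst T eq (ℚ.≤⇒≤ᵇ (ℚ.≤-trans (*≤⇒g≤ (cut t + suc r) t (≤cut⇒*≤ (suc t) long))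
                                             (ℚ.≤-reflexive (ℚ.≃-sym (mass+1/w mass≃)))))

  segments-from-cut : ∀ f t mass → mass ≃ frac t w → w ≤ t + f →
                      ∀ {s i} → t ≤ s → s < w → i ∈seg s →
                      segVal w (segments n c h w f (suc (cut t)) mass) i ≡ frac 1 (segLen s * w)
  segments-from-cut zero    t _ _ w≤t+0 t≤s s<w _ =
    ⊥-elim (<⇒≱ s<w (≤-trans (subst (w ≤_) (+-identityʳ t) w≤t+0) t≤s))
  segments-from-cut (suc f) t mass mass≃ w≤t+f {s} {i} t≤s s<w i∈s
    rewrite segments-step f (suc (cut t)) mass
              (≤-trans (≤-<-trans (cut-mono t≤s) (lower i∈s))
                       (≤-trans (upper i∈s) (subst (cut (suc s) ≤_) cut-w (cut-mono s<w))))
          | choice-cut t mass mass≃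
          | <ᵇ-false {i} {suc (cut t)} (≤-<-trans (cut-mono t≤s) (lower i∈s))
          | sym (cut-suc≡cut+segLen t)
          with m≤n⇒m<n∨m≡n t≤s
  ... | inj₂ refl rewrite <ᵇ-false (upper i∈s) = refl
  ... | inj₁ t<s  rewrite <ᵇ-true (≤-<-trans (cut-mono t<s) (lower i∈s)) =
    segments-from-cut f (suc t) _ (ℚ.≃-trans (ℚ.+-congʳ mass (frac-cancelˡ (0<segLen t) 0<w)) (mass+1/w mass≃))
                      (subst (w ≤_) (+-suc t f) w≤t+f) t<s s<w i∈s

  yvec-interior : ∀ {i} → 0 < i → i ≤ p → yvec n c h w i ≡ ŷ i
  yvec-interior {suc i} 0<i i≤p rewrite <ᵇ-false i≤p =
    subst (λ v → segVal w (segments n c h w n (suc v) 0ℚᵘ) (suc i) ≡ ŷ (suc i)) cut-zero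
      (segments-from-cut n 0 0ℚᵘ (ℚ.≃-sym (frac-zero 0<w)) (≤-trans w≤p (m≤n+m p 2))
                         z≤n (segOf<w 0<i i≤p) (segOf-∈ 0<i))

  yvec-end : yvec n c h w (suc p) ≡ 0ℚᵘ
  yvec-end rewrite <ᵇ-true (n<1+n p) = refl

  -- The windows C(T_v)

  y : ℕ → ℚᵘ
  y = yvec n c h w

  ∑y : ℕ → ℕ → ℚᵘ
  ∑y = ∑ (λ i → y (i % n))

  y-inside : ∀ {i} → 0 < i → i ≤ p → y (i % n) ≡ ŷ i
  y-inside 0<i i≤p = trans (cong y (m<n⇒m%n≡m (s≤s (≤-trans i≤p (n≤1+n p))))) (yvec-interior 0<i i≤p)

  ∑y-inside : ∀ v ℓ → 0 < v → v + ℓ ≤ suc p → ∑y v ℓ ≡ ∑ ŷ v ℓ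
  ∑y-inside v ℓ 0<v v+ℓ≤ = ∑-cong v v ℓ λ j j<ℓ →
    y-inside (≤-trans 0<v (m≤m+n v j)) (≤-pred (≤-trans (+-monoʳ-< v j<ℓ) v+ℓ≤))

  module _ (c<p : c < p) where

    ySum-CT-start : ySum y (CT n c 0) ≃ frac h w
    ySum-CT-start = begin
      ySum y (CT n c 0)             ≡⟨ cong (ySum y) (CT-hit n c 0 0 z≤n (inj₁ refl)) ⟩
      ySum y (intervalL n 0 (suc c)) ≡⟨ ySum-intervalL y n 0 (suc c) ⟩
      0ℚᵘ +q ∑y 1 c                 ≡⟨ ℚ.+-identityˡ-≡ (∑y 1 c) ⟩
      ∑y 1 c                        ≡⟨ ∑y-inside 1 c (s≤s z≤n) (s≤s (<⇒≤ c<p)) ⟩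
      ∑ ŷ 1 c                       ≈⟨ ∑ŷ-period ⟩
      frac h w                      ∎
      where open ℚ.≃-Reasoning

    ySum-CT-inner : ∀ v → 0 < v → v + c < suc p → ySum y (CT n c v) ≃ frac h w
    ySum-CT-inner v 0<v v+c<n-1 = begin
      ySum y (CT n c v)          ≡⟨ cong (ySum y) (CT-miss n c v avoid) ⟩
      ySum y (intervalL n v c)   ≡⟨ ySum-intervalL y n v c ⟩
      ∑y v c                     ≡⟨ ∑y-inside v c 0<v (<⇒≤ v+c<n-1) ⟩
      ∑ ŷ v c                    ≈⟨ ∑ŷ-window v 0<v ⟩
      frac h w                   ∎
      where
      open ℚ.≃-Reasoning
      avoid : ∀ j → j ≤ c → (v + j) % n ≢ 0 × (v + j) % n ≢ n ∸ 1
      avoid j j≤c = subst (λ x → x ≢ 0 × x ≢ n ∸ 1) (sym (m<n⇒m%n≡m (s≤s (<⇒≤ v+j<n-1))))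
                      ((λ v+j≡0 → <⇒≢ (≤-trans 0<v (m≤m+n v j)) (sym v+j≡0)) , <⇒≢ v+j<n-1)
        where
        v+j<n-1 : v + j < suc p
        v+j<n-1 = ≤-<-trans (+-monoʳ-≤ v j≤c) v+c<n-1

    ySum-CT-last : ∀ v → 0 < v → v + c ≡ suc p → ySum y (CT n c v) ≃ frac h w
    ySum-CT-last v 0<v v+c≡n-1 = begin
      ySum y (CT n c v)              ≡⟨ cong (ySum y) (CT-hit n c v c ≤-refl (inj₂ last)) ⟩
      ySum y (intervalL n v (suc c)) ≡⟨ ySum-intervalL y n v (suc c) ⟩
      ∑y v (suc c)                   ≡⟨ ∑-snoc _ v c ⟩
      ∑y v c +q y ((v + c) % n)      ≡⟨ cong₂ _+q_ (∑y-inside v c 0<v (≤-reflexive v+c≡n-1))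
                                                   (trans (cong y last) yvec-end) ⟩
      ∑ ŷ v c +q 0ℚᵘ                 ≡⟨ ℚ.+-identityʳ-≡ (∑ ŷ v c) ⟩
      ∑ ŷ v c                        ≈⟨ ∑ŷ-window v 0<v ⟩
      frac h w                       ∎
      where
      open ℚ.≃-Reasoning
      last : (v + c) % n ≡ suc p
      last = trans (cong (_% n) v+c≡n-1) (m<n⇒m%n≡m ≤-refl)

    ∑y-wrapped : ∀ b → b ≤ c → ∑y (suc n) b ≡ ∑ ŷ 1 b
    ∑y-wrapped b b≤c = ∑-cong (suc n) 1 b λ j j<b → begin
      y ((suc n + j) % n)   ≡⟨ cong (λ x → y (x % n)) (trans (+-comm (suc n) j) (+-suc j n)) ⟩
      y ((suc j + n) % n)   ≡⟨ cong y ([m+n]%n≡m%n (suc j) n) ⟩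
      y (suc j % n)         ≡⟨ y-inside (s≤s z≤n) (≤-trans j<b (≤-trans b≤c (<⇒≤ c<p))) ⟩
      ŷ (suc j)             ∎
      where open ≡-Reasoning

    ySum-CT-wrap : ∀ v → v ≤ suc p → suc p < v + c → ySum y (CT n c v) ≤q frac h w
    ySum-CT-wrap v v≤n-1 n-1<v+c = begin
      ySum y (CT n c v)                   ≡⟨ cong (ySum y) (CT-hit n c v a (<⇒≤ a<c) (inj₂ hit)) ⟩
      ySum y (intervalL n v (suc c))      ≡⟨ ySum-intervalL y n v (suc c) ⟩
      ∑y v (suc c)                        ≡⟨ cong (∑y v) (trans (cong suc (sym a+b+1≡c)) (sym (+-suc a (suc b)))) ⟩
      ∑y v (a + suc (suc b))              ≡⟨ ∑-split _ v a (suc (suc b)) ⟩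
      ∑y v a +q (y ((v + a) % n) +q (y (suc (v + a) % n) +q ∑y (suc (suc (v + a))) b))
                                          ≡⟨ cong₂ _+q_ (∑y-inside v a 0<v (≤-reflexive v+a≡))
                                               (cong₂ _+q_ (trans (cong y hit) yvec-end) (cong₂ _+q_ y-zero tail)) ⟩
      ∑ ŷ v a +q (0ℚᵘ +q (0ℚᵘ +q ∑ ŷ 1 b)) ≡⟨ cong₂ _+q_ (∑ŷ-reflect 0<v v+a≡)
                                               (trans (ℚ.+-identityˡ-≡ _) (ℚ.+-identityˡ-≡ _)) ⟩
      ∑ ŷ 1 a +q ∑ ŷ 1 b                  ≤⟨ ∑ŷ-wrap a+b+1≡c ⟩
      frac h w                            ∎
      where
      open ℚ.≤-Reasoning
      a = suc p ∸ v
      b = c ∸ suc a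
      v+a≡ : v + a ≡ suc p
      v+a≡ = m+[n∸m]≡n v≤n-1
      0<v : 0 < v
      0<v = ≰⇒> λ v≤0 →
        <⇒≱ n-1<v+c (subst (λ x → x + c ≤ suc p) (sym (n≤0⇒n≡0 v≤0)) (≤-trans (<⇒≤ c<p) (n≤1+n p)))
      a<c : a < c
      a<c = +-cancelˡ-< v a c (subst (_< v + c) (sym v+a≡) n-1<v+c)
      a+b+1≡c : a + suc b ≡ c
      a+b+1≡c = trans (+-suc a b) (m+[n∸m]≡n a<c)
      hit : (v + a) % n ≡ n ∸ 1
      hit = trans (cong (_% n) v+a≡) (m<n⇒m%n≡m ≤-refl)
      y-zero : y (suc (v + a) % n) ≡ 0ℚᵘ
      y-zero = cong y (trans (cong (λ x → suc x % n) v+a≡) (n%n≡0 n))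
      tail : ∑y (suc (suc (v + a))) b ≡ ∑ ŷ 1 b
      tail = trans (cong (λ x → ∑y (suc (suc x)) b) v+a≡) (∑y-wrapped b (m∸n≤m c (suc a)))

    ySum-CT≤ : ∀ v → v < n → ySum y (CT n c v) ≤q frac h w
    ySum-CT≤ zero    _   = ℚ.≤-reflexive ySum-CT-start
    ySum-CT≤ (suc v) v<n with <-cmp (suc v + c) (suc p)
    ... | tri< v+c<n-1 _ _ = ℚ.≤-reflexive (ySum-CT-inner (suc v) (s≤s z≤n) v+c<n-1)
    ... | tri≈ _ v+c≡n-1 _ = ℚ.≤-reflexive (ySum-CT-last (suc v) (s≤s z≤n) v+c≡n-1)
    ... | tri> _ _ n-1<v+c = ySum-CT-wrap (suc v) (≤-pred v<n) n-1<v+c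

lemma3p8 : (k n : ℕ) → k ≥ 2 → n > 2 ^ k → gcd (2 ^ k ∸ 2) (n ∸ 1) ≡ 1 →
    (h w : ℕ) → 0 < h → 0 < w → w ≤ n ∸ 2 →
    h * (n ∸ 1) ≡ w * (2 ^ k ∸ 2) + 1 →
    (∀ h′ w′ → 0 < w′ → h′ * (n ∸ 1) ≡ w′ * (2 ^ k ∸ 2) + 1 → w ≤ w′) →
    .{{_ : NonZero n}} →
    (v : ℕ) → v < n → v ≢ 1 →
    ySum (yvec n (2 ^ k ∸ 2) h w) (CT n (2 ^ k ∸ 2) v) ≤q frac h w
lemma3p8 k zero          _   ()
lemma3p8 k (suc zero)    k≥2 (s≤s 2^k≤0) = ⊥-elim (<⇒≱ (≤-trans (s≤s z≤n) (^-monoʳ-≤ 2 k≥2)) 2^k≤0)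
lemma3p8 k (suc (suc p)) k≥2 2^k<n _ h w 0<h 0<w w≤p bezout _ v v<n _ =
  Balanced.ySum-CT≤ c h w p {{>-nonZero 0<c}} {{>-nonZero 0<h}} {{>-nonZero 0<w}} bezout w≤p c<p v v<n
  where
  c = 2 ^ k ∸ 2
  4≤2^k : 4 ≤ 2 ^ k
  4≤2^k = ^-monoʳ-≤ 2 k≥2
  0<c : 0 < c
  0<c = ≤-trans (s≤s z≤n) (∸-monoˡ-≤ 2 4≤2^k)
  c<p : c < p
  c<p = ≤-pred (≤-pred (subst (_< suc (suc p)) (trans (sym c+2≡2^k) (+-comm c 2)) 2^k<n))
    where c+2≡2^k = m∸n+n≡m (≤-trans (s≤s (s≤s z≤n)) 4≤2^k)
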